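{- Let $n$ be a positive integer and $t,y,r,x\in \mathbb{Z}$ with $\gcd(r,n)=1=\gcd(x,n)$. Then $\kappa(n,r,t)=\kappa\left(n,r,(1-r)y+xt\right)$ and $\gcd\left(n, tS_{|r|_n}(r)\right)=\gcd\left(n,((1-r)y+xt)S_{|r|_n}(r)\right)$.
   Context: $|r|_n$ is the multiplicative order of $r$ modulo $n$. $S_k(x)=1+x+\cdots+x^{k-1}$ for $k\ge1$, $S_0(x)=0$; $\kappa(n,r,t)=\dfrac{n|r|_n}{\gcd(n,\ tS_{|r|_n}(r))}$. -}

module Defs where

open import Data.Nat as ℕ using (ℕ; zero; suc; _≤_; _<_)
import Data.Nat.DivMod as ℕDM
open import Data.Integer as ℤ using (ℤ; +_; _+_; _-_; _*_; _^_; ∣_∣)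
open import Data.Integer.Divisibility using (_∣_)
open import Data.Integer.GCD using (gcd)
open import Data.Product using (_×_)

S : ℕ → ℤ → ℤ
S zero    x = + 0
S (suc k) x = S k x + x ^ k

IsOrder : ℕ → ℤ → ℕ → Set
IsOrder n r k =
  (1 ℕ.≤ k) × ((+ n) ∣ (r ^ k - + 1)) ×
  (∀ j → 1 ℕ.≤ j → (+ n) ∣ (r ^ j - + 1) → k ℕ.≤ j)

-- natural-number division returning 0 for divisor 0 (never used with divisor 0
-- in the statement, since n > 0 forces gcd(n, _) > 0)
_÷_ : ℕ → ℕ → ℕ
m ÷ zero  = 0
m ÷ suc d = m ℕDM./ suc d

-- κ(n,r,t) = n |r|_n / gcd(n, t S_{|r|_n}(r)); the argument k is to be
-- instantiated with the multiplicative order |r|_n (see IsOrder)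
κ : (n : ℕ) → (r : ℤ) → (k : ℕ) → (t : ℤ) → ℕ
κ n r k t = (n ℕ.* k) ÷ ∣ gcd (+ n) (t * S k r) ∣

{-# OPTIONS --safe #-}
module Submission where

-- Since (r − 1) S_k(r) = r^k − 1 and n ∣ r^k − 1 for k = |r|_n, we have
--   ((1 − r) y + x t) S_k(r) = x (t S_k(r)) + (a multiple of n),
-- and neither adding a multiple of n nor multiplying by a unit x modulo n
-- changes the gcd with n. κ depends on t only through that gcd.

open import Defs
open import Data.Nat using (ℕ; _<_)
import Data.Nat as ℕ
import Data.Nat.Divisibility as ℕ using (_∣_; ∣-antisym)
import Data.Nat.Coprimality as ℕ using (coprime-factors; gcd≡1⇒coprime)
open import Data.Integer using (ℤ; +_; -_; _+_; _-_; _*_; _^_; ∣_∣)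
open import Data.Integer.Properties using (*-distribˡ-+; *-zeroʳ; abs-*; +-injective)
open import Data.Integer.Divisibility.Signed
  using (_∣_; ∣ᵤ⇒∣; ∣⇒∣ᵤ; ∣-trans; ∣m⇒∣-m; ∣m⇒∣m*n; ∣n⇒∣m*n; ∣m∣n⇒∣m+n; ∣m+n∣m⇒∣n)
open import Data.Integer.GCD using (gcd; gcd[i,j]∣i; gcd[i,j]∣j; gcd-greatest)
open import Data.Integer.Coprimality using (Coprime)
open import Data.Integer.Tactic.RingSolver using (solve-∀)
open import Data.Product using (_×_; _,_)
open import Relation.Binary.PropositionalEquality using (_≡_; cong; subst)
open Relation.Binary.PropositionalEquality.≡-Reasoning

[r-1]*S[k,r]≡r^k-1 : ∀ k r → (r - + 1) * S k r ≡ r ^ k - + 1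
[r-1]*S[k,r]≡r^k-1 ℕ.zero    r = *-zeroʳ (r - + 1)
[r-1]*S[k,r]≡r^k-1 (ℕ.suc k) r = begin
  (r - + 1) * (S k r + r ^ k)           ≡⟨ *-distribˡ-+ (r - + 1) (S k r) (r ^ k) ⟩
  (r - + 1) * S k r + (r - + 1) * r ^ k ≡⟨ cong (_+ (r - + 1) * r ^ k) ([r-1]*S[k,r]≡r^k-1 k r) ⟩
  r ^ k - + 1 + (r - + 1) * r ^ k       ≡⟨ telescope r (r ^ k) ⟩
  r * r ^ k - + 1                       ∎
  where
  telescope : ∀ r p → p - + 1 + (r - + 1) * p ≡ r * p - + 1
  telescope = solve-∀

∣r^k-1⇒∣[1-r]*S[k,r] : ∀ {i} k r → i ∣ r ^ k - + 1 → i ∣ (+ 1 - r) * S k r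
∣r^k-1⇒∣[1-r]*S[k,r] {i} k r i∣r^k-1 = subst (i ∣_) -[r^k-1]≡[1-r]*S (∣m⇒∣-m i∣r^k-1)
  where
  negate : ∀ r s → - ((r - + 1) * s) ≡ (+ 1 - r) * s
  negate = solve-∀
  -[r^k-1]≡[1-r]*S : - (r ^ k - + 1) ≡ (+ 1 - r) * S k r
  -[r^k-1]≡[1-r]*S = begin
    - (r ^ k - + 1)       ≡⟨ cong -_ ([r-1]*S[k,r]≡r^k-1 k r) ⟨
    - ((r - + 1) * S k r) ≡⟨ negate r (S k r) ⟩
    (+ 1 - r) * S k r     ∎

gcd-cong-commonDivisors : ∀ {i j k} →
  (∀ {d} → d ∣ i → d ∣ j → d ∣ k) → (∀ {d} → d ∣ i → d ∣ k → d ∣ j) →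
  gcd i j ≡ gcd i k
gcd-cong-commonDivisors {i} j⇒k k⇒j = cong +_ (ℕ.∣-antisym (gcd∣gcd j⇒k) (gcd∣gcd k⇒j))
  where
  gcd∣gcd : ∀ {j k} → (∀ {d} → d ∣ i → d ∣ j → d ∣ k) → ∣ gcd i j ∣ ℕ.∣ ∣ gcd i k ∣
  gcd∣gcd {j} {k} j⇒k = gcd-greatest {i} {k} {gcd i j} (gcd[i,j]∣i i j)
    (∣⇒∣ᵤ (j⇒k (∣ᵤ⇒∣ {gcd i j} {i} (gcd[i,j]∣i i j)) (∣ᵤ⇒∣ {gcd i j} {j} (gcd[i,j]∣j i j))))

gcd[i,c+j]≡gcd[i,j] : ∀ {i c} j → i ∣ c → gcd i (c + j) ≡ gcd i j
gcd[i,c+j]≡gcd[i,j] j i∣c = gcd-cong-commonDivisors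
  (λ d∣i d∣c+j → ∣m+n∣m⇒∣n d∣c+j (∣-trans d∣i i∣c))
  (λ d∣i d∣j → ∣m∣n⇒∣m+n (∣-trans d∣i i∣c) d∣j)

gcd[i,x*j]≡gcd[i,j] : ∀ i x j → Coprime x i → gcd i (x * j) ≡ gcd i j
gcd[i,x*j]≡gcd[i,j] i x j x⊥i = gcd-cong-commonDivisors d∣j (λ _ d∣j → ∣n⇒∣m*n x d∣j)
  where
  d∣j : ∀ {d} → d ∣ i → d ∣ x * j → d ∣ j
  d∣j {d} d∣i d∣x*j = ∣ᵤ⇒∣ (ℕ.coprime-factors x⊥i
    ( subst (∣ d ∣ ℕ.∣_) (abs-* x j) (∣⇒∣ᵤ d∣x*j)
    , subst (∣ d ∣ ℕ.∣_) (abs-* i j) (∣⇒∣ᵤ (∣m⇒∣m*n j d∣i))))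

gcd[i,t*S]≡gcd[i,[[1-r]*y+x*t]*S] : ∀ {i} k r x y t → i ∣ r ^ k - + 1 → Coprime x i →
  gcd i (t * S k r) ≡ gcd i (((+ 1 - r) * y + x * t) * S k r)
gcd[i,t*S]≡gcd[i,[[1-r]*y+x*t]*S] {i} k r x y t i∣r^k-1 x⊥i = begin
  gcd i (t * S k r)                                  ≡⟨ gcd[i,x*j]≡gcd[i,j] i x (t * S k r) x⊥i ⟨
  gcd i (x * (t * S k r))                            ≡⟨ gcd[i,c+j]≡gcd[i,j] (x * (t * S k r)) i∣[1-r]*S*y ⟨
  gcd i ((+ 1 - r) * S k r * y + x * (t * S k r))    ≡⟨ cong (gcd i) (regroup r y x t (S k r)) ⟩
  gcd i (((+ 1 - r) * y + x * t) * S k r)            ∎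
  where
  i∣[1-r]*S*y : i ∣ (+ 1 - r) * S k r * y
  i∣[1-r]*S*y = ∣m⇒∣m*n y (∣r^k-1⇒∣[1-r]*S[k,r] k r i∣r^k-1)
  regroup : ∀ r y x t s → (+ 1 - r) * s * y + x * (t * s) ≡ ((+ 1 - r) * y + x * t) * s
  regroup = solve-∀

corollary3p5 : (n : ℕ) → 0 < n → (t y r x : ℤ) →
    gcd r (+ n) ≡ + 1 → gcd x (+ n) ≡ + 1 →
    (k : ℕ) → IsOrder n r k →
    (κ n r k t ≡ κ n r k ((+ 1 - r) * y + x * t))
    × (gcd (+ n) (t * S k r) ≡ gcd (+ n) (((+ 1 - r) * y + x * t) * S k r))
corollary3p5 n _ t y r x _ gcd[x,n]≡1 k (_ , n∣r^k-1 , _) =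
  cong (λ g → (n ℕ.* k) ÷ ∣ g ∣) gcd-invariant , gcd-invariant
  where
  gcd-invariant : gcd (+ n) (t * S k r) ≡ gcd (+ n) (((+ 1 - r) * y + x * t) * S k r)
  gcd-invariant = gcd[i,t*S]≡gcd[i,[[1-r]*y+x*t]*S] k r x y t
    (∣ᵤ⇒∣ {+ n} n∣r^k-1) (ℕ.gcd≡1⇒coprime (+-injective gcd[x,n]≡1))
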